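{- Let $p$ be a prime, $c\in\mathbb F_p$ non-zero, and $A\subseteq\mathbb F_p$ with $|A|=\alpha p$ such that the equation $x-y=cz$ has no solutions with $x,y,z\in A$. Then $\mathrm{cov}^\times(A)\geqslant\kappa\,\frac{\log p}{\log(1/\alpha)}$ for an absolute constant $\kappa>0$.
   Context: $\mathbb F_p^*=\mathbb F_p\setminus\{0\}$. $\mathrm{cov}^\times(S)=\min\{|X|:X\subseteq\mathbb F_p^*,\ (S\cap\mathbb F_p^*)\cdot X=\mathbb F_p^*\}$ is the multiplicative covering number. -}

module Defs where

open import Data.Nat using (ℕ; NonZero; _+_; _*_; _%_)
open import Data.Fin using (Fin; toℕ)
open import Data.Fin.Subset using (Subset; _∈_)
open import Data.Product using (Σ; _×_)
open import Relation.Binary.PropositionalEquality using (_≡_; _≢_)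

-- 𝔽_p is modelled as Fin p, with arithmetic taken mod p on representatives.
module _ (p : ℕ) .{{_ : NonZero p}} where

  NoSolution : Fin p → Subset p → Set
  NoSolution c A = ∀ (x y z : Fin p) → x ∈ A → y ∈ A → z ∈ A →
                   toℕ x % p ≢ (toℕ y + toℕ c * toℕ z) % p

  -- X ⊆ 𝔽_p^* and (A ∩ 𝔽_p^*) · X = 𝔽_p^*
  IsMulCover : Subset p → Subset p → Set
  IsMulCover A X =
      (∀ x → x ∈ X → toℕ x ≢ 0)
    × (∀ s x → s ∈ A → toℕ s ≢ 0 → x ∈ X → (toℕ s * toℕ x) % p ≢ 0)
    × (∀ (t : Fin p) → toℕ t ≢ 0 →
         Σ (Fin p) λ s → Σ (Fin p) λ x →
           s ∈ A × toℕ s ≢ 0 × x ∈ X × toℕ t ≡ (toℕ s * toℕ x) % p)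

{-# OPTIONS --safe #-}
-- For every x ∈ X pick u_x with u_x x ≡ ±c. Starting from I = 𝔽_p, run through
-- x ∈ X and keep only the r ∈ I with u_x r + w_x ∈ A, the translate w_x chosen
-- by averaging over all p translates so that at least the fraction |A|/p of I
-- survives; at the end |I| ≥ p (|A|/p)^|X|. But |I| ≤ 1: if r < r′ both lay in I,
-- write r′ - r = s x with s ∈ A, x ∈ X; then the two elements u_x r′ + w_x and
-- u_x r + w_x of A differ by u_x s x = ±c s, a solution of x - y = c z in A.
-- Hence p |A|^|X| ≤ p^|X|, which is the claim with κ = 1.
module Submission where

open import Data.Nat using (ℕ; NonZero; _*_; _^_; _≤_)
open import Data.Nat.Primality using (Prime)
open import Data.Fin using (Fin; toℕ)
open import Data.Fin.Subset using (Subset; ∣_∣)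
open import Data.Product using (Σ; _×_)
open import Relation.Binary.PropositionalEquality using (_≢_)
open import Defs

open import Data.Nat.Properties
open import Algebra.Properties.Semiring.Sum +-*-semiring
  using (sum; sum-syntax; sum-cong-≗; sum-init-last; ∑-comm; *-distribˡ-sum; *-distribʳ-sum)
open import Data.Bool using (Bool; true; false; _∧_)
open import Data.Empty using (⊥; ⊥-elim)
open import Data.Fin using (zero; suc; fromℕ<; fromℕ; inject₁) renaming (_<_ to _<ᶠ_)
open import Data.Fin.Properties using (toℕ-fromℕ<; toℕ-fromℕ; toℕ-inject₁; toℕ<n; toℕ-injective) renaming (<-cmp to <ᶠ-cmp)
open import Data.Fin.Subset using (_∈_; _⊆_; _∩_; inside; outside; ⊤; ⁅_⁆)
open import Data.Fin.Subset.Properties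
  using (nonempty?; Empty-unique; ∣⊥∣≡0; ∣⊤∣≡n; x∈⁅x⁆; ∣⁅x⁆∣≡1; p⊆q⇒∣p∣≤∣q∣; p∩q⊆p; p∩q⊆q)
open import Data.Nat using (suc; zero; _+_; _∸_; _<_; _%_; z≤n; ≢-nonZero)
open import Data.Nat.Coprimality using (prime⇒coprime; coprime-Bézout)
open import Data.Nat.DivMod using (_mod_; m%n%n≡m%n; [m+n]%n≡m%n; [m+kn]%n≡m%n; m<n⇒m%n≡m; %-distribˡ-+; %-distribˡ-*)
open import Data.Nat.GCD using (module Bézout)
open import Data.Nat.Solver using (module +-*-Solver)
open import Data.Product using (∃; _,_; proj₁; proj₂)
open import Data.Sum using (_⊎_; inj₁; inj₂)
open import Data.Vec using ([]; _∷_; lookup; tabulate; here; there)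
open import Data.Vec.Functional using (Vector)
open import Data.Vec.Properties using (lookup-zipWith; lookup∘tabulate; []=⇒lookup; lookup⇒[]=)
open import Function using (_∘_)
open import Relation.Binary using (tri<; tri≈; tri>)
open import Relation.Binary.PropositionalEquality
  using (_≡_; refl; sym; trans; cong; cong₂; subst; module ≡-Reasoning)
import Relation.Binary.PropositionalEquality as ≡
import Relation.Binary.Construct.On as On
import Relation.Binary.Reasoning.Setoid as SetoidReasoning
open import Relation.Nullary using (yes; no)

open +-*-Solver

𝟙 : Bool → ℕ
𝟙 true = 1
𝟙 false = 0

𝟙-∧ : ∀ a b → 𝟙 (a ∧ b) ≡ 𝟙 a * 𝟙 b
𝟙-∧ true b = sym (+-identityʳ (𝟙 b))
𝟙-∧ false b = refl

∣p∣≡∑𝟙 : ∀ {n} (q : Subset n) → ∣ q ∣ ≡ ∑[ i < n ] 𝟙 (lookup q i)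
∣p∣≡∑𝟙 [] = refl
∣p∣≡∑𝟙 (outside ∷ q) = ∣p∣≡∑𝟙 q
∣p∣≡∑𝟙 (inside ∷ q) = cong suc (∣p∣≡∑𝟙 q)

∣p∩q∣≡∑𝟙*𝟙 : ∀ {n} (q r : Subset n) →
             ∣ q ∩ r ∣ ≡ ∑[ i < n ] (𝟙 (lookup q i) * 𝟙 (lookup r i))
∣p∩q∣≡∑𝟙*𝟙 q r = trans (∣p∣≡∑𝟙 (q ∩ r))
  (sum-cong-≗ λ i → trans (cong 𝟙 (lookup-zipWith _∧_ i q r)) (𝟙-∧ (lookup q i) (lookup r i)))

unique⇒∣p∣≤1 : ∀ {n} (q : Subset n) → (∀ {x y} → x ∈ q → y ∈ q → x ≡ y) → ∣ q ∣ ≤ 1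
unique⇒∣p∣≤1 {n} q unique with nonempty? q
... | yes (x , x∈q) = begin
  ∣ q ∣     ≤⟨ p⊆q⇒∣p∣≤∣q∣ (λ y∈q → subst (_∈ ⁅ x ⁆) (unique x∈q y∈q) (x∈⁅x⁆ x)) ⟩
  ∣ ⁅ x ⁆ ∣ ≡⟨ ∣⁅x⁆∣≡1 x ⟩
  1         ∎
  where open ≤-Reasoning
... | no empty = ≤-trans (≤-reflexive (trans (cong ∣_∣ (Empty-unique empty)) (∣⊥∣≡0 n))) z≤n

<⇒∃-difference : ∀ {n} {r r′ : Fin n} → r <ᶠ r′ →
                 ∃ λ (t : Fin n) → toℕ t ≢ 0 × toℕ r + toℕ t ≡ toℕ r′
<⇒∃-difference {n} {r} {r′} r<r′ =
  fromℕ< t<n , (λ t≡0 → m>n⇒m∸n≢0 r<r′ (trans (sym (toℕ-fromℕ< t<n)) t≡0)) ,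
  trans (cong (toℕ r +_) (toℕ-fromℕ< t<n)) (m+[n∸m]≡n (<⇒≤ r<r′))
  where
  t<n : toℕ r′ ∸ toℕ r < n
  t<n = ≤-<-trans (m∸n≤m (toℕ r′) (toℕ r)) (toℕ<n r′)

sum≤n*max : ∀ {n} .{{_ : NonZero n}} (f : Vector ℕ n) → ∃ λ i → sum f ≤ n * f i
sum≤n*max {suc zero} f = zero , ≤-refl
sum≤n*max {suc (suc n)} f with sum≤n*max (f ∘ suc)
... | i , ∑tail≤ with ≤-total (f zero) (f (suc i))
...   | inj₁ f₀≤fᵢ = suc i , +-mono-≤ f₀≤fᵢ ∑tail≤
...   | inj₂ fᵢ≤f₀ = zero , +-monoʳ-≤ (f zero) (≤-trans ∑tail≤ (*-monoʳ-≤ (suc n) fᵢ≤f₀))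

∑-shift-periodic : ∀ {n} (g : ℕ → ℕ) → (∀ k → g (k + n) ≡ g k) →
                   ∀ k → ∑[ i < n ] g (k + toℕ i) ≡ ∑[ i < n ] g (toℕ i)
∑-shift-periodic g periodic zero = refl
∑-shift-periodic {zero} g periodic (suc k) = refl
∑-shift-periodic {suc n} g periodic (suc k) = trans shift (∑-shift-periodic g periodic k)
  where
  open ≡-Reasoning
  shift : ∑[ i < suc n ] g (suc k + toℕ i) ≡ ∑[ i < suc n ] g (k + toℕ i)
  shift = begin
    ∑[ i < suc n ] g (suc k + toℕ i)
      ≡⟨ sum-init-last (λ i → g (suc k + toℕ i)) ⟩
    ∑[ i < n ] g (suc k + toℕ (inject₁ i)) + g (suc k + toℕ (fromℕ n))
      ≡⟨ cong₂ _+_ (sum-cong-≗ {n} λ i → cong g (trans (cong (suc k +_) (toℕ-inject₁ i)) (sym (+-suc k (toℕ i)))))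
                   (cong g (trans (cong (suc k +_) (toℕ-fromℕ n)) (sym (+-suc k n)))) ⟩
    ∑[ i < n ] g (k + suc (toℕ i)) + g (k + suc n)
      ≡⟨ cong₂ _+_ refl (trans (periodic k) (cong g (sym (+-identityʳ k)))) ⟩
    ∑[ i < n ] g (k + suc (toℕ i)) + g (k + 0)
      ≡⟨ +-comm (∑[ i < n ] g (k + suc (toℕ i))) (g (k + 0)) ⟩
    ∑[ i < suc n ] g (k + toℕ i) ∎

module _ {n : ℕ} .{{_ : NonZero n}} where

  toℕ-mod : ∀ m → toℕ (m mod n) ≡ m % n
  toℕ-mod m = toℕ-fromℕ< _

  toℕ-mod-id : ∀ (i : Fin n) → toℕ i mod n ≡ i
  toℕ-mod-id i = toℕ-injective (trans (toℕ-mod (toℕ i)) (m<n⇒m%n≡m (toℕ<n i)))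

  ∑-rotate : ∀ (f : Vector ℕ n) k → ∑[ i < n ] f ((k + toℕ i) mod n) ≡ sum f
  ∑-rotate f k = trans (∑-shift-periodic (f ∘ (_mod n)) periodic k)
                       (sum-cong-≗ λ i → cong f (toℕ-mod-id i))
    where
    periodic : ∀ j → f ((j + n) mod n) ≡ f (j mod n)
    periodic j = cong f (toℕ-injective (trans (toℕ-mod (j + n))
                                          (trans ([m+n]%n≡m%n j n) (sym (toℕ-mod j)))))

preimage : ∀ {m n} → (Fin m → Fin n) → Subset n → Subset m
preimage f q = tabulate (lookup q ∘ f)

∈-preimage⁻ : ∀ {m n} {f : Fin m → Fin n} {q : Subset n} {i} → i ∈ preimage f q → f i ∈ q
∈-preimage⁻ {f = f} {q} {i} i∈ =
  lookup⇒[]= (f i) q (trans (sym (lookup∘tabulate (lookup q ∘ f) i)) ([]=⇒lookup i∈))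

^-bound-step : ∀ {p a e i j} → p * a ^ e ≤ p ^ e * i → i * a ≤ p * j →
               p * a ^ suc e ≤ p ^ suc e * j
^-bound-step {p} {a} {e} {i} {j} bound step = begin
  p * (a * a ^ e)   ≡⟨ solve 3 (λ p a q → p :* (a :* q) := a :* (p :* q)) refl p a (a ^ e) ⟩
  a * (p * a ^ e)   ≤⟨ *-monoʳ-≤ a bound ⟩
  a * (p ^ e * i)   ≡⟨ solve 3 (λ a q i → a :* (q :* i) := q :* (i :* a)) refl a (p ^ e) i ⟩
  p ^ e * (i * a)   ≤⟨ *-monoʳ-≤ (p ^ e) step ⟩
  p ^ e * (p * j)   ≡⟨ solve 3 (λ q p j → q :* (p :* j) := p :* q :* j) refl (p ^ e) p j ⟩
  p * p ^ e * j     ∎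
  where open ≤-Reasoning

infix 4 _≡_[mod_] _≡±_[mod_]

_≡_[mod_] : ℕ → ℕ → (p : ℕ) .{{_ : NonZero p}} → Set
m ≡ n [mod p ] = m % p ≡ n % p

-- Bézout in ℕ yields an inverse only up to sign; that suffices, since both
-- x - y = c z and y - x = c z are excluded.
_≡±_[mod_] : ℕ → ℕ → (p : ℕ) .{{_ : NonZero p}} → Set
m ≡± k [mod p ] = m ≡ k [mod p ] ⊎ m + k ≡ 0 [mod p ]

module _ {p : ℕ} .{{_ : NonZero p}} where

  module ≡-mod-Reasoning = SetoidReasoning (On.setoid (≡.setoid ℕ) (_% p))

  %≡[mod] : ∀ m → m % p ≡ m [mod p ]
  %≡[mod] m = m%n%n≡m%n m p

  +-cong-mod : ∀ {m m′ n n′} → m ≡ m′ [mod p ] → n ≡ n′ [mod p ] → m + n ≡ m′ + n′ [mod p ]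
  +-cong-mod {m} {m′} {n} {n′} m≡m′ n≡n′ = begin
    (m + n) % p                 ≡⟨ %-distribˡ-+ m n p ⟩
    (m % p + n % p) % p         ≡⟨ cong₂ (λ a b → (a + b) % p) m≡m′ n≡n′ ⟩
    (m′ % p + n′ % p) % p       ≡⟨ %-distribˡ-+ m′ n′ p ⟨
    (m′ + n′) % p               ∎
    where open ≡-Reasoning

  *-cong-mod : ∀ {m m′ n n′} → m ≡ m′ [mod p ] → n ≡ n′ [mod p ] → m * n ≡ m′ * n′ [mod p ]
  *-cong-mod {m} {m′} {n} {n′} m≡m′ n≡n′ = begin
    (m * n) % p                 ≡⟨ %-distribˡ-* m n p ⟩
    (m % p * (n % p)) % p       ≡⟨ cong₂ (λ a b → (a * b) % p) m≡m′ n≡n′ ⟩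
    (m′ % p * (n′ % p)) % p     ≡⟨ %-distribˡ-* m′ n′ p ⟨
    (m′ * n′) % p               ∎
    where open ≡-Reasoning

  prime⇒≡±1 : Prime p → ∀ {x} .{{_ : NonZero x}} → x < p → ∃ λ y → x * y ≡± 1 [mod p ]
  prime⇒≡±1 p-prime {x} x<p with coprime-Bézout (prime⇒coprime p-prime x<p)
  ... | Bézout.+- a y 1+yx≡ap = y , inj₂ (begin
    x * y + 1 ≡⟨ trans (+-comm (x * y) 1) (cong suc (*-comm x y)) ⟩
    1 + y * x ≡⟨ 1+yx≡ap ⟩
    a * p     ≈⟨ [m+kn]%n≡m%n 0 a p ⟩
    0         ∎)
    where open ≡-mod-Reasoning
  ... | Bézout.-+ a y 1+ap≡yx = y , inj₁ (begin
    x * y     ≡⟨ *-comm x y ⟩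
    y * x     ≡⟨ 1+ap≡yx ⟨
    1 + a * p ≈⟨ [m+kn]%n≡m%n 1 a p ⟩
    1         ∎)
    where open ≡-mod-Reasoning

  ≡±1⇒≡±c : ∀ {m y} → m * y ≡± 1 [mod p ] → ∀ c → m * (y * c) ≡± c [mod p ]
  ≡±1⇒≡±c {m} {y} (inj₁ my≡1) c = inj₁ (begin
    m * (y * c) ≡⟨ *-assoc m y c ⟨
    m * y * c   ≈⟨ *-cong-mod my≡1 refl ⟩
    1 * c       ≡⟨ *-identityˡ c ⟩
    c           ∎)
    where open ≡-mod-Reasoning
  ≡±1⇒≡±c {m} {y} (inj₂ my+1≡0) c = inj₂ (begin
    m * (y * c) + c ≡⟨ solve 3 (λ m y c → m :* (y :* c) :+ c := (m :* y :+ con 1) :* c) refl m y c ⟩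
    (m * y + 1) * c ≈⟨ *-cong-mod my+1≡0 refl ⟩
    0               ∎)
    where open ≡-mod-Reasoning

module _ {p : ℕ} .{{_ : NonZero p}} where

  affine : ℕ → ℕ → Fin p → Fin p
  affine u w r = (u * toℕ r + w) mod p

  toℕ-affine : ∀ u w r → toℕ (affine u w r) ≡ u * toℕ r + w [mod p ]
  toℕ-affine u w r = trans (cong (_% p) (toℕ-mod (u * toℕ r + w))) (%≡[mod] (u * toℕ r + w))

  affine-gap : ∀ {u w x} {r r′ s : Fin p} → toℕ r′ ≡ toℕ r + toℕ s * x [mod p ] →
               toℕ (affine u w r′) ≡ toℕ (affine u w r) + x * u * toℕ s [mod p ]
  affine-gap {u} {w} {x} {r} {r′} {s} r′≡r+sx = begin
    toℕ (affine u w r′)                   ≈⟨ toℕ-affine u w r′ ⟩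
    u * toℕ r′ + w                        ≈⟨ +-cong-mod (*-cong-mod {m = u} refl r′≡r+sx) refl ⟩
    u * (toℕ r + toℕ s * x) + w           ≡⟨ solve 5 (λ u r s x w → u :* (r :+ s :* x) :+ w := (u :* r :+ w) :+ x :* u :* s)
                                                     refl u (toℕ r) (toℕ s) x w ⟩
    (u * toℕ r + w) + x * u * toℕ s       ≈⟨ +-cong-mod (toℕ-affine u w r) refl ⟨
    toℕ (affine u w r) + x * u * toℕ s    ∎
    where open ≡-mod-Reasoning

  module _ (A : Subset p) where

    ∑∣I∩affine-preimage∣ : ∀ (I : Subset p) u →
      ∑[ w < p ] ∣ I ∩ preimage (affine u (toℕ w)) A ∣ ≡ ∣ I ∣ * ∣ A ∣
    ∑∣I∩affine-preimage∣ I u = begin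
      ∑[ w < p ] ∣ I ∩ preimage (affine u (toℕ w)) A ∣
        ≡⟨ sum-cong-≗ {p} (λ w → trans (∣p∩q∣≡∑𝟙*𝟙 I (preimage (affine u (toℕ w)) A))
             (sum-cong-≗ {p} λ r → cong (λ b → 𝟙 (I′ r) * 𝟙 b)
               (lookup∘tabulate (A′ ∘ affine u (toℕ w)) r))) ⟩
      ∑[ w < p ] ∑[ r < p ] (𝟙 (I′ r) * 𝟙 (A′ (affine u (toℕ w) r)))
        ≡⟨ ∑-comm {p} {p} (λ w r → 𝟙 (I′ r) * 𝟙 (A′ (affine u (toℕ w) r))) ⟩
      ∑[ r < p ] ∑[ w < p ] (𝟙 (I′ r) * 𝟙 (A′ (affine u (toℕ w) r)))
        ≡⟨ sum-cong-≗ {p} (λ r → *-distribˡ-sum {p} (𝟙 (I′ r)) (λ w → 𝟙 (A′ (affine u (toℕ w) r)))) ⟨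
      ∑[ r < p ] (𝟙 (I′ r) * ∑[ w < p ] 𝟙 (A′ ((u * toℕ r + toℕ w) mod p)))
        ≡⟨ sum-cong-≗ {p} (λ r → cong (𝟙 (I′ r) *_) (trans (∑-rotate (𝟙 ∘ A′) (u * toℕ r)) (sym (∣p∣≡∑𝟙 A)))) ⟩
      ∑[ r < p ] (𝟙 (I′ r) * ∣ A ∣)
        ≡⟨ *-distribʳ-sum ∣ A ∣ (𝟙 ∘ I′) ⟨
      ∑[ r < p ] 𝟙 (I′ r) * ∣ A ∣
        ≡⟨ cong (_* ∣ A ∣) (∣p∣≡∑𝟙 I) ⟨
      ∣ I ∣ * ∣ A ∣ ∎
      where
      open ≡-Reasoning
      I′ A′ : Fin p → Bool
      I′ = lookup I
      A′ = lookup A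

    large-affine-preimage : ∀ (I : Subset p) u →
      ∃ λ w → ∣ I ∣ * ∣ A ∣ ≤ p * ∣ I ∩ preimage (affine u w) A ∣
    large-affine-preimage I u =
      let w , ∑≤ = sum≤n*max (λ w → ∣ I ∩ preimage (affine u (toℕ w)) A ∣)
      in toℕ w , subst (_≤ p * ∣ I ∩ preimage (affine u (toℕ w)) A ∣) (∑∣I∩affine-preimage∣ I u) ∑≤

    affine-refinement : ∀ {n} (X : Subset n) (u : ∀ {x} → x ∈ X → ℕ) →
      ∃ λ (I : Subset p) → p * ∣ A ∣ ^ ∣ X ∣ ≤ p ^ ∣ X ∣ * ∣ I ∣ ×
        (∀ {x} (x∈X : x ∈ X) → ∃ λ w → I ⊆ preimage (affine (u x∈X) w) A)
    affine-refinement [] u = ⊤ , ≤-reflexive p*1≡1*∣⊤∣ , λ ()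
      where
      p*1≡1*∣⊤∣ : p * 1 ≡ 1 * ∣ ⊤ {p} ∣
      p*1≡1*∣⊤∣ = trans (*-identityʳ p) (sym (trans (*-identityˡ ∣ ⊤ {p} ∣) (∣⊤∣≡n p)))
    affine-refinement (outside ∷ X) u =
      let I , bound , fits = affine-refinement X (u ∘ there)
      in I , bound , λ { (there x∈X) → fits x∈X }
    affine-refinement (inside ∷ X) u =
      let I , bound , fits = affine-refinement X (u ∘ there)
          w , large = large-affine-preimage I (u here)
          I′ = I ∩ preimage (affine (u here) w) A
          fits′ : ∀ {x} (x∈X : x ∈ inside ∷ X) → ∃ λ w → I′ ⊆ preimage (affine (u x∈X) w) A
          fits′ = λ { here → w , p∩q⊆q I _
                    ; (there x∈X) → let w′ , I⊆ = fits x∈X in w′ , I⊆ ∘ p∩q⊆p I _ }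
      in I′ , ^-bound-step {p} {∣ A ∣} {∣ X ∣} {∣ I ∣} bound large , fits′

  module _ {c : Fin p} {A : Subset p} (noSol : NoSolution p c A) where

    affine-pair∉A : ∀ {u w x} → x * u ≡± toℕ c [mod p ] →
                    ∀ {r r′ s : Fin p} → s ∈ A → toℕ r′ ≡ toℕ r + toℕ s * x [mod p ] →
                    affine u w r ∈ A → affine u w r′ ∈ A → ⊥
    affine-pair∉A {u} {w} {x} (inj₁ xu≡c) {r} {r′} {s} s∈A r′≡r+sx a∈A a′∈A =
      noSol (affine u w r′) (affine u w r) s a′∈A a∈A s∈A (begin
        toℕ (affine u w r′)                  ≈⟨ affine-gap {u} {w} {x} {r} {r′} {s} r′≡r+sx ⟩
        toℕ (affine u w r) + x * u * toℕ s   ≈⟨ +-cong-mod refl (*-cong-mod xu≡c refl) ⟩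
        toℕ (affine u w r) + toℕ c * toℕ s   ∎)
      where open ≡-mod-Reasoning
    affine-pair∉A {u} {w} {x} (inj₂ xu+c≡0) {r} {r′} {s} s∈A r′≡r+sx a∈A a′∈A =
      noSol (affine u w r) (affine u w r′) s a∈A a′∈A s∈A (sym (begin
        a′ + c′ * s′            ≈⟨ +-cong-mod (affine-gap {u} {w} {x} {r} {r′} {s} r′≡r+sx) refl ⟩
        a + x * u * s′ + c′ * s′ ≡⟨ solve 5 (λ a x u s c → a :+ x :* u :* s :+ c :* s := a :+ (x :* u :+ c) :* s)
                                           refl a x u s′ c′ ⟩
        a + (x * u + c′) * s′   ≈⟨ +-cong-mod refl (*-cong-mod xu+c≡0 refl) ⟩
        a + 0                  ≡⟨ +-identityʳ a ⟩
        a                      ∎))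
      where
      open ≡-mod-Reasoning
      a a′ c′ s′ : ℕ
      a = toℕ (affine u w r)
      a′ = toℕ (affine u w r′)
      c′ = toℕ c
      s′ = toℕ s

module _ {p : ℕ} .{{_ : NonZero p}} (p-prime : Prime p) {c : Fin p} {A X : Subset p}
         (noSol : NoSolution p c A) (cover : IsMulCover p A X) where

  ±c-multiplier : ∀ {x} → x ∈ X → ∃ λ u → toℕ x * u ≡± toℕ c [mod p ]
  ±c-multiplier {x} x∈X =
    let y , xy≡±1 = prime⇒≡±1 p-prime {{≢-nonZero (proj₁ cover x x∈X)}} (toℕ<n x)
    in y * toℕ c , ≡±1⇒≡±c {m = toℕ x} xy≡±1 (toℕ c)

  SentIntoA : Subset p → Set
  SentIntoA I = ∀ {x} (x∈X : x ∈ X) → ∃ λ w → I ⊆ preimage (affine (proj₁ (±c-multiplier x∈X)) w) A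

  sentIntoA⇒¬ordered-pair : ∀ {I} → SentIntoA I → ∀ {r r′} → r <ᶠ r′ → r ∈ I → r′ ∈ I → ⊥
  sentIntoA⇒¬ordered-pair fits {r} {r′} r<r′ r∈I r′∈I =
    let t , t≢0 , r+t≡r′ = <⇒∃-difference r<r′
        s , x , s∈A , _ , x∈X , t≡sx = proj₂ (proj₂ cover) t t≢0
        w , I⊆ = fits x∈X
        r′≡r+sx : toℕ r′ ≡ toℕ r + toℕ s * toℕ x [mod p ]
        r′≡r+sx = trans (cong (_% p) (sym r+t≡r′))
                    (+-cong-mod refl (trans (cong (_% p) t≡sx) (%≡[mod] (toℕ s * toℕ x))))
    in affine-pair∉A {c = c} noSol (proj₂ (±c-multiplier x∈X)) s∈A r′≡r+sx
                     (∈-preimage⁻ (I⊆ r∈I)) (∈-preimage⁻ (I⊆ r′∈I))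

  sentIntoA⇒unique : ∀ {I} → SentIntoA I → ∀ {r r′} → r ∈ I → r′ ∈ I → r ≡ r′
  sentIntoA⇒unique fits {r} {r′} r∈I r′∈I with <ᶠ-cmp r r′
  ... | tri< r<r′ _ _ = ⊥-elim (sentIntoA⇒¬ordered-pair fits r<r′ r∈I r′∈I)
  ... | tri≈ _ r≡r′ _ = r≡r′
  ... | tri> _ _ r′<r = ⊥-elim (sentIntoA⇒¬ordered-pair fits r′<r r′∈I r∈I)

  mul-cover-bound : p * ∣ A ∣ ^ ∣ X ∣ ≤ p ^ ∣ X ∣
  mul-cover-bound =
    let I , bound , fits = affine-refinement A X (λ x∈X → proj₁ (±c-multiplier x∈X))
    in begin
      p * ∣ A ∣ ^ ∣ X ∣  ≤⟨ bound ⟩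
      p ^ ∣ X ∣ * ∣ I ∣  ≤⟨ *-monoʳ-≤ (p ^ ∣ X ∣) (unique⇒∣p∣≤1 I (sentIntoA⇒unique fits)) ⟩
      p ^ ∣ X ∣ * 1      ≡⟨ *-identityʳ (p ^ ∣ X ∣) ⟩
      p ^ ∣ X ∣          ∎
    where open ≤-Reasoning

corollary36 : Σ ℕ λ K → 1 ≤ K ×
    (∀ (p : ℕ) .{{_ : NonZero p}} → Prime p →
      (c : Fin p) → toℕ c ≢ 0 →
      (A : Subset p) → NoSolution p c A →
      (X : Subset p) → IsMulCover p A X →
      p * ∣ A ∣ ^ (K * ∣ X ∣) ≤ p ^ (K * ∣ X ∣))
corollary36 = 1 , ≤-refl , λ p p-prime c _ A noSol X cover →
  subst (λ k → p * ∣ A ∣ ^ k ≤ p ^ k) (sym (*-identityˡ ∣ X ∣)) (mul-cover-bound p-prime {c = c} noSol cover)
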